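{- (Completeness of the proof-search procedure.) For all annotated terms $g,d$: if the sequent $(g,d)$ is derivable in the orthologic sequent calculus $\mathsf{OL}$, then there exists a natural number $n$ such that $\mathrm{decide}(n,g,d)=\mathrm{true}$.
   Context: Terms: generated from variables $x_p$ ($p$ a positive integer) by binary $\wedge$, binary $\vee$ and unary $\neg$. Annotated terms: $N$, $L(t)$, $R(t)$ for terms $t$. A sequent is an ordered pair $(g,d)$ of annotated terms. Rules of $\mathsf{OL}$ (annotated terms $g,d$, terms $a,b$): Hyp: $(L(a),R(a))$. Weaken: from $(g,N)$ infer $(g,d)$. Contract: from $(g,g)$ infer $(g,N)$. Swap: from $(g,d)$ infer $(d,g)$. LeftAnd1/2: from $(L(a),d)$ (resp. $(L(b),d)$) infer $(L(a\wedge b),d)$. LeftOr: from $(L(a),d)$ and $(L(b),d)$ infer $(L(a\vee b),d)$. LeftNot: from $(R(a),d)$ infer $(L(\neg a),d)$. RightOr1/2: from $(g,R(a))$ (resp. $(g,R(b))$) infer $(g,R(a\vee b))$. RightAnd: from $(g,R(a))$ and $(g,R(b))$ infer $(g,R(a\wedge b))$. RightNot: from $(g,L(a))$ infer $(g,R(\neg a))$. Cut: from $(g,R(b))$ and $(L(b),d)$ infer $(g,d)$. The boolean function $\mathrm{decide}(n,g,d)$ is defined by recursion on $n$: $\mathrm{decide}(0,g,d)=\mathrm{false}$, and $\mathrm{decide}(n+1,g,d)=\mathrm{true}$ iff at least one of the following holds (writing $D=\mathrm{decide}(n,\cdot,\cdot)$): $g=L(x_p)$, $d=R(x_q)$, $p=q$;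 $D(g,N)$; $d=N$ and $D(g,g)$; $g=L(a\wedge b)$ and $D(L(a),d)$; $g=L(a\wedge b)$ and $D(L(b),d)$; $g=L(a\vee b)$ and $D(L(a),d)$ and $D(L(b),d)$; $g=L(\neg a)$ and $D(R(a),d)$; $d=R(a\vee b)$ and $D(g,R(a))$; $d=R(a\vee b)$ and $D(g,R(b))$; $d=R(a\wedge b)$ and $D(g,R(a))$ and $D(g,R(b))$; $d=R(\neg a)$ and $D(g,L(a))$; $D(d,g)$. -}

module Defs where

open import Data.Nat using (ℕ; zero; suc)
open import Data.Nat.Properties using (_≟_)
open import Data.Bool using (Bool; true; false; _∧_; _∨_)
open import Relation.Nullary using (Dec; yes; no; does)
open import Relation.Binary.PropositionalEquality using (_≡_; refl)

-- Terms. Variable x_p for positive p is represented as (var p);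
-- the index p = 0 is never used in the paper.
data Term : Set where
  var : ℕ → Term
  _∧ₜ_ : Term → Term → Term
  _∨ₜ_ : Term → Term → Term
  ¬ₜ_ : Term → Term

data ATerm : Set where
  N : ATerm
  L : Term → ATerm
  R : Term → ATerm

data OL : ATerm → ATerm → Set where
  hyp      : ∀ a → OL (L a) (R a)
  weaken   : ∀ {g} d → OL g N → OL g d
  contract : ∀ {g} → OL g g → OL g N
  swap     : ∀ {g d} → OL g d → OL d g
  leftAnd1 : ∀ {a d} b → OL (L a) d → OL (L (a ∧ₜ b)) d
  leftAnd2 : ∀ {b d} a → OL (L b) d → OL (L (a ∧ₜ b)) d
  leftOr   : ∀ {a b d} → OL (L a) d → OL (L b) d → OL (L (a ∨ₜ b)) d
  leftNot  : ∀ {a d} → OL (R a) d → OL (L (¬ₜ a)) d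
  rightOr1 : ∀ {g a} b → OL g (R a) → OL g (R (a ∨ₜ b))
  rightOr2 : ∀ {g b} a → OL g (R b) → OL g (R (a ∨ₜ b))
  rightAnd : ∀ {g a b} → OL g (R a) → OL g (R b) → OL g (R (a ∧ₜ b))
  rightNot : ∀ {g a} → OL g (L a) → OL g (R (¬ₜ a))
  cut      : ∀ {g d b} → OL g (R b) → OL (L b) d → OL g d

isN : ATerm → Bool
isN N = true
isN _ = false

decide : ℕ → ATerm → ATerm → Bool
decide zero g d = false
decide (suc n) g d =
  hypC g d
  ∨ D g N
  ∨ (isN d ∧ D g g)
  ∨ leftC g
  ∨ rightC d
  ∨ D d g
  where
  D : ATerm → ATerm → Bool
  D = decide n
  hypC : ATerm → ATerm → Bool
  hypC (L (var p)) (R (var q)) = does (p ≟ q)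
  hypC _ _ = false
  leftC : ATerm → Bool
  leftC (L (a ∧ₜ b)) = D (L a) d ∨ D (L b) d
  leftC (L (a ∨ₜ b)) = D (L a) d ∧ D (L b) d
  leftC (L (¬ₜ a)) = D (R a) d
  leftC _ = false
  rightC : ATerm → Bool
  rightC (R (a ∨ₜ b)) = D g (R a) ∨ D g (R b)
  rightC (R (a ∧ₜ b)) = D g (R a) ∧ D g (R b)
  rightC (R (¬ₜ a)) = D g (L a)
  rightC _ = false

-- Completeness of decide goes through cut elimination. In a cut-free presentation of OL where
-- every logical rule acts on the first component (the second being reached through swap), cut is
-- admissible: a multicut, which removes the cut formula from both components at once and hence
-- commutes with contraction, is proved by induction on the cut term and then on the two
-- derivations. Every rule of a cut-free derivation is a clause of decide, so once the premises of
-- binary rules are lifted to a common height, decide finds the derivation.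
module Submission where

open import Defs
open import Data.Nat using (ℕ; suc; _≤_; s≤s; _⊔_)
open import Data.Nat.Properties using (_≟_; m≤m⊔n; m≤n⊔m)
open import Data.Bool using (Bool; true; false; _∧_; _∨_)
open import Data.Product using (∃; _,_; map; map₂)
open import Relation.Nullary using (does)
open import Relation.Nullary.Decidable using (dec-true)
open import Relation.Binary.PropositionalEquality using (_≡_; refl; trans)

data Rule₁ : ATerm → ATerm → Set where
  ∧L₁ : ∀ {a b} → Rule₁ (L a) (L (a ∧ₜ b))
  ∧L₂ : ∀ {a b} → Rule₁ (L b) (L (a ∧ₜ b))
  ¬L  : ∀ {a} → Rule₁ (R a) (L (¬ₜ a))
  ∨R₁ : ∀ {a b} → Rule₁ (R a) (R (a ∨ₜ b))
  ∨R₂ : ∀ {a b} → Rule₁ (R b) (R (a ∨ₜ b))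
  ¬R  : ∀ {a} → Rule₁ (L a) (R (¬ₜ a))

data Rule₂ : ATerm → ATerm → ATerm → Set where
  ∨L : ∀ {a b} → Rule₂ (L a) (L b) (L (a ∨ₜ b))
  ∧R : ∀ {a b} → Rule₂ (R a) (R b) (R (a ∧ₜ b))

-- Rules acting on the second component are derived (rule₁ʳ, rule₂ʳ), which halves the cases of
-- multicut.
data CutFree : ATerm → ATerm → Set where
  hyp      : ∀ p → CutFree (L (var p)) (R (var p))
  weaken   : ∀ {g} d → CutFree g N → CutFree g d
  contract : ∀ {g} → CutFree g g → CutFree g N
  swap     : ∀ {g d} → CutFree d g → CutFree g d
  rule₁    : ∀ {h g d} → Rule₁ h g → CutFree h d → CutFree g d
  rule₂    : ∀ {h₁ h₂ g d} → Rule₂ h₁ h₂ g → CutFree h₁ d → CutFree h₂ d → CutFree g d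

rule₁ʳ : ∀ {g h d} → Rule₁ h d → CutFree g h → CutFree g d
rule₁ʳ ρ D = swap (rule₁ ρ (swap D))

rule₂ʳ : ∀ {g h₁ h₂ d} → Rule₂ h₁ h₂ d → CutFree g h₁ → CutFree g h₂ → CutFree g d
rule₂ʳ ρ D E = swap (rule₂ ρ (swap D) (swap E))

identity : ∀ a → CutFree (L a) (R a)
identity (var p) = hyp p
identity (a ∧ₜ b) = rule₂ʳ ∧R (rule₁ ∧L₁ (identity a)) (rule₁ ∧L₂ (identity b))
identity (a ∨ₜ b) = rule₂ ∨L (rule₁ʳ ∨R₁ (identity a)) (rule₁ʳ ∨R₂ (identity b))
identity (¬ₜ a) = rule₁ ¬L (rule₁ʳ ¬R (swap (identity a)))

-- Split F g d X: the sequent (g , d) consists of the cut formula F and the residue X, where F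
-- occurs in the first component, the second, or both (with residue N).
data Front (F : ATerm) : ATerm → ATerm → Set where
  single : ∀ {X} → Front F X X
  double : Front F F N

data Split (F : ATerm) : ATerm → ATerm → ATerm → Set where
  front : ∀ {d X} → Front F d X → Split F F d X
  back  : ∀ {X} → Split F X F X

Split-swap : ∀ {F g d X} → Split F g d X → Split F d g X
Split-swap (front single) = back
Split-swap (front double) = front double
Split-swap back = front single

focus : ∀ {F g d X} → CutFree g d → Split F g d X → CutFree F X
focus D (front single) = D
focus D (front double) = contract D
focus D back = swap D

mutual
  multicut : ∀ b {g d g′ d′ X Y} → CutFree g d → CutFree g′ d′ →
             Split (R b) g d X → Split (L b) g′ d′ Y → CutFree X Y
  multicut b (hyp p) D₂ back s₂ = focus D₂ s₂
  multicut b (swap D) D₂ s₁ s₂ = multicut b D D₂ (Split-swap s₁) s₂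
  multicut b (weaken _ D) D₂ (front single) s₂ =
    swap (weaken _ (swap (multicut b D D₂ (front single) s₂)))
  multicut b (weaken _ D) D₂ (front double) s₂ = multicut b D D₂ (front single) s₂
  multicut b (weaken _ D) D₂ back s₂ = weaken _ D
  multicut b (contract D) D₂ (front single) s₂ = multicut b D D₂ (front double) s₂
  multicut b (rule₁ ρ D) D₂ back s₂ = rule₁ ρ (multicut b D D₂ back s₂)
  multicut b (rule₂ ρ D E) D₂ back s₂ =
    rule₂ ρ (multicut b D D₂ back s₂) (multicut b E D₂ back s₂)
  multicut b D₁ (hyp p) s₁ (front single) = swap (focus D₁ s₁)
  multicut b D₁ (swap D) s₁ s₂ = multicut b D₁ D s₁ (Split-swap s₂)
  multicut b D₁ (weaken _ D) s₁ (front single) = weaken _ (multicut b D₁ D s₁ (front single))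
  multicut b D₁ (weaken _ D) s₁ (front double) = multicut b D₁ D s₁ (front single)
  multicut b D₁ (weaken _ D) s₁ back = swap (weaken _ D)
  multicut b D₁ (contract D) s₁ (front single) = multicut b D₁ D s₁ (front double)
  multicut b D₁ (rule₁ ρ D) s₁ back = rule₁ʳ ρ (multicut b D₁ D s₁ back)
  multicut b D₁ (rule₂ ρ D E) s₁ back =
    rule₂ʳ ρ (multicut b D₁ D s₁ back) (multicut b D₁ E s₁ back)
  multicut (a ∨ₜ c) D₁@(rule₁ ∨R₁ p) D₂@(rule₂ ∨L r t) (front o₁) (front o₂) =
    principal _ (λ u v → multicut a u v (front single) (front single)) D₁ D₂ p r o₁ o₂
  multicut (a ∨ₜ c) D₁@(rule₁ ∨R₂ p) D₂@(rule₂ ∨L r t) (front o₁) (front o₂) =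
    principal _ (λ u v → multicut c u v (front single) (front single)) D₁ D₂ p t o₁ o₂
  multicut (a ∧ₜ c) D₁@(rule₂ ∧R p q) D₂@(rule₁ ∧L₁ r) (front o₁) (front o₂) =
    principal _ (λ u v → multicut a u v (front single) (front single)) D₁ D₂ p r o₁ o₂
  multicut (a ∧ₜ c) D₁@(rule₂ ∧R p q) D₂@(rule₁ ∧L₂ r) (front o₁) (front o₂) =
    principal _ (λ u v → multicut c u v (front single) (front single)) D₁ D₂ q r o₁ o₂
  multicut (¬ₜ a) D₁@(rule₁ ¬R p) D₂@(rule₁ ¬L r) (front o₁) (front o₂) =
    principal _ (λ u v → swap (multicut a v u (front single) (front single))) D₁ D₂ p r o₁ o₂
  multicut _ (rule₂ ∧R _ _) (rule₂ () _ _) (front _) (front _)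

  -- A copy of the cut formula left in the second component of a premise is first removed by a
  -- multicut on the same term against a smaller derivation.
  principal : ∀ b {F F̄ d d′ X Y} → (∀ {U V} → CutFree F U → CutFree F̄ V → CutFree U V) →
              CutFree (R b) d → CutFree (L b) d′ → CutFree F d → CutFree F̄ d′ →
              Front (R b) d X → Front (L b) d′ Y → CutFree X Y
  principal b subcut D₁ D₂ p r single single = subcut p r
  principal b subcut D₁ D₂ p r single double =
    contract (subcut p (swap (multicut b D₁ r (front single) back)))
  principal b subcut D₁ D₂ p r double single =
    swap (contract (subcut (multicut b p D₂ back (front single)) r))
  principal b subcut D₁ D₂ p r double double =
    subcut (multicut b p D₂ back (front double)) (swap (multicut b D₁ r (front double) back))

cut-admissible : ∀ {g b d} → CutFree g (R b) → CutFree (L b) d → CutFree g d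
cut-admissible {b = b} D₁ D₂ = multicut b D₁ D₂ back (front single)

cut-elimination : ∀ {g d} → OL g d → CutFree g d
cut-elimination (hyp a) = identity a
cut-elimination (weaken d D) = weaken d (cut-elimination D)
cut-elimination (contract D) = contract (cut-elimination D)
cut-elimination (swap D) = swap (cut-elimination D)
cut-elimination (leftAnd1 b D) = rule₁ ∧L₁ (cut-elimination D)
cut-elimination (leftAnd2 a D) = rule₁ ∧L₂ (cut-elimination D)
cut-elimination (leftOr D E) = rule₂ ∨L (cut-elimination D) (cut-elimination E)
cut-elimination (leftNot D) = rule₁ ¬L (cut-elimination D)
cut-elimination (rightOr1 b D) = rule₁ʳ ∨R₁ (cut-elimination D)
cut-elimination (rightOr2 a D) = rule₁ʳ ∨R₂ (cut-elimination D)
cut-elimination (rightAnd D E) = rule₂ʳ ∧R (cut-elimination D) (cut-elimination E)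
cut-elimination (rightNot D) = rule₁ʳ ¬R (cut-elimination D)
cut-elimination (cut D E) = cut-admissible (cut-elimination D) (cut-elimination E)

-- Search n g d: a cut-free derivation whose rules are the clauses of decide, of height at most n.
data Search : ℕ → ATerm → ATerm → Set where
  hyp      : ∀ {n} p → Search (suc n) (L (var p)) (R (var p))
  weaken   : ∀ {n g} d → Search n g N → Search (suc n) g d
  contract : ∀ {n g} → Search n g g → Search (suc n) g N
  swap     : ∀ {n g d} → Search n d g → Search (suc n) g d
  left₁    : ∀ {n h a d} → Rule₁ h (L a) → Search n h d → Search (suc n) (L a) d
  left₂    : ∀ {n h₁ h₂ a d} → Rule₂ h₁ h₂ (L a) → Search n h₁ d → Search n h₂ d →
             Search (suc n) (L a) d
  right₁   : ∀ {n g h a} → Rule₁ h (R a) → Search n g h → Search (suc n) g (R a)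
  right₂   : ∀ {n g h₁ h₂ a} → Rule₂ h₁ h₂ (R a) → Search n g h₁ → Search n g h₂ →
             Search (suc n) g (R a)

Search-mono : ∀ {m n g d} → m ≤ n → Search m g d → Search n g d
Search-mono (s≤s m≤n) (hyp p) = hyp p
Search-mono (s≤s m≤n) (weaken d s) = weaken d (Search-mono m≤n s)
Search-mono (s≤s m≤n) (contract s) = contract (Search-mono m≤n s)
Search-mono (s≤s m≤n) (swap s) = swap (Search-mono m≤n s)
Search-mono (s≤s m≤n) (left₁ ρ s) = left₁ ρ (Search-mono m≤n s)
Search-mono (s≤s m≤n) (left₂ ρ s t) = left₂ ρ (Search-mono m≤n s) (Search-mono m≤n t)
Search-mono (s≤s m≤n) (right₁ ρ s) = right₁ ρ (Search-mono m≤n s)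
Search-mono (s≤s m≤n) (right₂ ρ s t) = right₂ ρ (Search-mono m≤n s) (Search-mono m≤n t)

CutFree⇒Search : ∀ {g d} → CutFree g d → ∃ λ n → Search n g d
CutFree⇒Search (hyp p) = 1 , hyp p
CutFree⇒Search (weaken d D) = map suc (weaken d) (CutFree⇒Search D)
CutFree⇒Search (contract D) = map suc contract (CutFree⇒Search D)
CutFree⇒Search (swap D) = map suc swap (CutFree⇒Search D)
CutFree⇒Search (rule₁ {g = L _} ρ D) = map suc (left₁ ρ) (CutFree⇒Search D)
CutFree⇒Search (rule₁ {g = R _} ρ D) =
  map (λ n → suc (suc (suc n))) (λ s → swap (right₁ ρ (swap s))) (CutFree⇒Search D)
CutFree⇒Search (rule₂ {g = L _} ρ D E) with CutFree⇒Search D | CutFree⇒Search E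
... | m , s | n , t =
  suc (m ⊔ n) , left₂ ρ (Search-mono (m≤m⊔n m n) s) (Search-mono (m≤n⊔m m n) t)
CutFree⇒Search (rule₂ {g = R _} ρ D E) with CutFree⇒Search D | CutFree⇒Search E
... | m , s | n , t =
  suc (suc (suc (m ⊔ n))) ,
  swap (right₂ ρ (swap (Search-mono (m≤m⊔n m n) s)) (swap (Search-mono (m≤n⊔m m n) t)))

-- The where-bound functions of decide are not in scope here, so hypᵇ, leftᵇ and rightᵇ copy them;
-- they only agree definitionally once both annotated terms are split as deep as their case trees.
hypᵇ : ATerm → ATerm → Bool
hypᵇ (L (var p)) (R (var q)) = does (p ≟ q)
hypᵇ _ _ = false

leftᵇ : ℕ → ATerm → ATerm → Bool
leftᵇ n (L (a ∧ₜ b)) d = decide n (L a) d ∨ decide n (L b) d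
leftᵇ n (L (a ∨ₜ b)) d = decide n (L a) d ∧ decide n (L b) d
leftᵇ n (L (¬ₜ a)) d = decide n (R a) d
leftᵇ n _ d = false

rightᵇ : ℕ → ATerm → ATerm → Bool
rightᵇ n g (R (a ∨ₜ b)) = decide n g (R a) ∨ decide n g (R b)
rightᵇ n g (R (a ∧ₜ b)) = decide n g (R a) ∧ decide n g (R b)
rightᵇ n g (R (¬ₜ a)) = decide n g (L a)
rightᵇ n g _ = false

decide-suc : ∀ n g d → decide (suc n) g d ≡
  hypᵇ g d ∨ decide n g N ∨ (isN d ∧ decide n g g) ∨ leftᵇ n g d ∨ rightᵇ n g d ∨ decide n d g
decide-suc n N N = refl
decide-suc n N (L c) = refl
decide-suc n N (R (var q)) = refl
decide-suc n N (R (c ∧ₜ e)) = refl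
decide-suc n N (R (c ∨ₜ e)) = refl
decide-suc n N (R (¬ₜ c)) = refl
decide-suc n (R a) N = refl
decide-suc n (R a) (L c) = refl
decide-suc n (R a) (R (var q)) = refl
decide-suc n (R a) (R (c ∧ₜ e)) = refl
decide-suc n (R a) (R (c ∨ₜ e)) = refl
decide-suc n (R a) (R (¬ₜ c)) = refl
decide-suc n (L (var p)) N = refl
decide-suc n (L (var p)) (L c) = refl
decide-suc n (L (var p)) (R (var q)) = refl
decide-suc n (L (var p)) (R (c ∧ₜ e)) = refl
decide-suc n (L (var p)) (R (c ∨ₜ e)) = refl
decide-suc n (L (var p)) (R (¬ₜ c)) = refl
decide-suc n (L (a ∧ₜ b)) N = refl
decide-suc n (L (a ∧ₜ b)) (L c) = refl
decide-suc n (L (a ∧ₜ b)) (R (var q)) = refl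
decide-suc n (L (a ∧ₜ b)) (R (c ∧ₜ e)) = refl
decide-suc n (L (a ∧ₜ b)) (R (c ∨ₜ e)) = refl
decide-suc n (L (a ∧ₜ b)) (R (¬ₜ c)) = refl
decide-suc n (L (a ∨ₜ b)) N = refl
decide-suc n (L (a ∨ₜ b)) (L c) = refl
decide-suc n (L (a ∨ₜ b)) (R (var q)) = refl
decide-suc n (L (a ∨ₜ b)) (R (c ∧ₜ e)) = refl
decide-suc n (L (a ∨ₜ b)) (R (c ∨ₜ e)) = refl
decide-suc n (L (a ∨ₜ b)) (R (¬ₜ c)) = refl
decide-suc n (L (¬ₜ a)) N = refl
decide-suc n (L (¬ₜ a)) (L c) = refl
decide-suc n (L (¬ₜ a)) (R (var q)) = refl
decide-suc n (L (¬ₜ a)) (R (c ∧ₜ e)) = refl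
decide-suc n (L (¬ₜ a)) (R (c ∨ₜ e)) = refl
decide-suc n (L (¬ₜ a)) (R (¬ₜ c)) = refl

∨-introˡ : ∀ {x y} → x ≡ true → x ∨ y ≡ true
∨-introˡ refl = refl

∨-introʳ : ∀ x {y} → y ≡ true → x ∨ y ≡ true
∨-introʳ true _ = refl
∨-introʳ false y≡true = y≡true

∧-intro : ∀ {x y} → x ≡ true → y ≡ true → x ∧ y ≡ true
∧-intro refl refl = refl

-- For variable g and d, decide (suc n) g d unfolds to a stuck disjunction from which Agda cannot
-- infer n, g, d or the disjuncts skipped by ∨-introʳ, so these are passed explicitly.
module _ (n : ℕ) (g d : ATerm) where

  decide-weaken : decide n g N ≡ true → decide (suc n) g d ≡ true
  decide-weaken e = trans (decide-suc n g d) (∨-introʳ (hypᵇ g d) (∨-introˡ e))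

  decide-contract : isN d ∧ decide n g g ≡ true → decide (suc n) g d ≡ true
  decide-contract e = trans (decide-suc n g d)
    (∨-introʳ (hypᵇ g d) (∨-introʳ (decide n g N) (∨-introˡ e)))

  decide-left : leftᵇ n g d ≡ true → decide (suc n) g d ≡ true
  decide-left e = trans (decide-suc n g d)
    (∨-introʳ (hypᵇ g d) (∨-introʳ (decide n g N) (∨-introʳ (isN d ∧ decide n g g) (∨-introˡ e))))

  decide-right : rightᵇ n g d ≡ true → decide (suc n) g d ≡ true
  decide-right e = trans (decide-suc n g d)
    (∨-introʳ (hypᵇ g d) (∨-introʳ (decide n g N) (∨-introʳ (isN d ∧ decide n g g)
      (∨-introʳ (leftᵇ n g d) (∨-introˡ e)))))

  decide-swap : decide n d g ≡ true → decide (suc n) g d ≡ true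
  decide-swap e = trans (decide-suc n g d)
    (∨-introʳ (hypᵇ g d) (∨-introʳ (decide n g N) (∨-introʳ (isN d ∧ decide n g g)
      (∨-introʳ (leftᵇ n g d) (∨-introʳ (rightᵇ n g d) e)))))

Search⇒decide : ∀ {n g d} → Search n g d → decide n g d ≡ true
Search⇒decide (hyp p) = ∨-introˡ (dec-true (p ≟ p) refl)
Search⇒decide {suc n} {g} {d} (weaken _ s) = decide-weaken n g d (Search⇒decide s)
Search⇒decide {suc n} {g} (contract s) = decide-contract n g N (Search⇒decide s)
Search⇒decide {suc n} {g} {d} (swap s) = decide-swap n g d (Search⇒decide s)
Search⇒decide {suc n} {g} {d} (left₁ ∧L₁ s) = decide-left n g d (∨-introˡ (Search⇒decide s))
Search⇒decide {suc n} {g} {d} (left₁ (∧L₂ {a = a}) s) =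
  decide-left n g d (∨-introʳ (decide n (L a) d) (Search⇒decide s))
Search⇒decide {suc n} {g} {d} (left₁ ¬L s) = decide-left n g d (Search⇒decide s)
Search⇒decide {suc n} {g} {d} (left₂ ∨L s t) =
  decide-left n g d (∧-intro (Search⇒decide s) (Search⇒decide t))
Search⇒decide {suc n} {g} {d} (right₁ ∨R₁ s) = decide-right n g d (∨-introˡ (Search⇒decide s))
Search⇒decide {suc n} {g} {d} (right₁ (∨R₂ {a = a}) s) =
  decide-right n g d (∨-introʳ (decide n g (R a)) (Search⇒decide s))
Search⇒decide {suc n} {g} {d} (right₁ ¬R s) = decide-right n g d (Search⇒decide s)
Search⇒decide {suc n} {g} {d} (right₂ ∧R s t) =
  decide-right n g d (∧-intro (Search⇒decide s) (Search⇒decide t))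

mainTheorem4 : (g d : ATerm) → OL g d → ∃ λ (n : ℕ) → decide n g d ≡ true
mainTheorem4 g d h = map₂ Search⇒decide (CutFree⇒Search (cut-elimination h))
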